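{- Let $r\ge 2$ and $t\ge 3$ be integers, let $P_r=u_1u_2\cdots u_r$ be the path on $r$ vertices, and let $K_t$ and $N_t$ be the complete and empty graphs on a common vertex set of size $t$. Then: (i) if $r\in\{2,3\}$, then $(P_r\times K_t)_{SR}\cong \bigcup_{i=1}^t K_r$ (disjoint union of $t$ copies of $K_r$); (ii) if $r\ge 4$ and $P_2$ denotes the graph with vertex set $\{u_1,u_r\}$ and the single edge $u_1u_r$, then $(P_r\times K_t)_{SR}\cong (P_r\Box N_t)\sqcup (P_2\circ N_t)$.
   Context: All graphs are finite, simple and undirected; $d_G$ is the distance in $G$. A vertex $u$ is maximally distant from $v$ if $d_G(v,w)\le d_G(u,v)$ for every neighbor $w$ of $u$. Vertices $u,v$ are mutually maximally distant (MMD) if each is maximally distant from the other. The boundary $\partial(G)$ is the set of vertices maximally distant from some vertex of $G$. The strong resolving graph $G_{SR}$ has vertex set $\partial(G)$, two vertices being adjacent iff they are MMD in $G$. Products on vertex set $V(A)\times V(B)$: direct product $A\times B$: $(a,b)\sim(c,d)$ iff $ac\in E(A)$ and $bd\in E(B)$; Cartesian product $A\Box B$: $(a,b)\sim(c,d)$ iff ($a=c$ and $bd\in E(B)$) or ($ac\in E(A)$ and $b=d$); lexicographic product $A\circ B$: $(a,b)\sim(c,d)$ iff $ac\in E(A)$, or $a=c$ and $bd\in E(B)$. For graphs $A,B$ whose vertex sets are subsets of a common set (here $V(P_r)\times V(K_t)$), $A\sqcup B$ is the graph with vertex set $V(A)\cup V(B)$ and edge set $E(A)\cup E(B)$. -}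

module Defs where

open import Data.Nat using (ℕ; zero; suc; _≤_; _∸_)
open import Data.Fin using (Fin; toℕ)
open import Data.Product using (Σ; ∃; _×_; _,_)
open import Data.Sum using (_⊎_)
open import Data.Unit using (⊤)
open import Data.Empty using (⊥)
open import Relation.Nullary using (¬_)
open import Relation.Binary.PropositionalEquality using (_≡_; _≢_)
open import Function.Bundles using (_⇔_)

-- A graph whose vertex set is a subset (predicate `In`) of a carrier `X`,
-- with adjacency relation `Adj` (only relevant between vertices in `In`).
-- This lets graphs whose vertex sets are subsets of a common set be
-- combined (⊔) and lets G_SR have vertex set ∂(G) ⊆ V(G).
record Graph (X : Set) : Set₁ where
  field
    In  : X → Set
    Adj : X → X → Set
open Graph public

data Walk {X : Set} (G : Graph X) : X → X → ℕ → Set where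
  here : ∀ {u} → In G u → Walk G u u 0
  step : ∀ {u w v k} → In G u → Adj G u w → Walk G w v k → Walk G u v (suc k)

Dist : {X : Set} (G : Graph X) → X → X → ℕ → Set
Dist G u v k = Walk G u v k × (∀ m → Walk G u v m → k ≤ m)

MaxDist : {X : Set} (G : Graph X) → X → X → Set
MaxDist G u v = ∀ w → In G w → Adj G u w →
  ∀ k l → Dist G v w k → Dist G u v l → k ≤ l

MMD : {X : Set} (G : Graph X) → X → X → Set
MMD G u v = MaxDist G u v × MaxDist G v u

Boundary : {X : Set} (G : Graph X) → X → Set
Boundary {X} G u = In G u × Σ X (λ v → In G v × MaxDist G u v)

SR : {X : Set} → Graph X → Graph X
SR G = record { In = Boundary G ; Adj = MMD G }

Iso : {X Y : Set} → Graph X → Graph Y → Set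
Iso {X} {Y} G H = Σ (X → Y) λ f →
    (∀ x → In G x → In H (f x))
  × (∀ x y → In G x → In G y → f x ≡ f y → x ≡ y)
  × (∀ y → In H y → Σ X (λ x → In G x × f x ≡ y))
  × (∀ x y → In G x → In G y → Adj G x y ⇔ Adj H (f x) (f y))

-- Path P_r = u_1 … u_r on Fin r (u_i ↦ i-1)
Path : (r : ℕ) → Graph (Fin r)
Path r = record { In = λ _ → ⊤
                ; Adj = λ i j → toℕ j ≡ suc (toℕ i) ⊎ toℕ i ≡ suc (toℕ j) }

Complete : (t : ℕ) → Graph (Fin t)
Complete t = record { In = λ _ → ⊤ ; Adj = λ i j → i ≢ j }

EmptyG : (t : ℕ) → Graph (Fin t)
EmptyG t = record { In = λ _ → ⊤ ; Adj = λ _ _ → ⊥ }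

-- The graph "P_2" on vertex set {u_1, u_r} ⊆ V(P_r) with the single edge u_1 u_r.
EndsEdge : (r : ℕ) → Graph (Fin r)
EndsEdge r = record
  { In = λ a → toℕ a ≡ 0 ⊎ toℕ a ≡ r ∸ 1
  ; Adj = λ a c → (toℕ a ≡ 0 × toℕ c ≡ r ∸ 1) ⊎ (toℕ a ≡ r ∸ 1 × toℕ c ≡ 0) }

Copies : {X : Set} → (n : ℕ) → Graph X → Graph (Fin n × X)
Copies n H = record { In = λ { (i , x) → In H x }
                    ; Adj = λ { (i , x) (j , y) → i ≡ j × Adj H x y } }

_×ᴳ_ : {X Y : Set} → Graph X → Graph Y → Graph (X × Y)
A ×ᴳ B = record { In = λ { (a , b) → In A a × In B b }
                ; Adj = λ { (a , b) (c , d) → Adj A a c × Adj B b d } }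

_□_ : {X Y : Set} → Graph X → Graph Y → Graph (X × Y)
A □ B = record { In = λ { (a , b) → In A a × In B b }
               ; Adj = λ { (a , b) (c , d) → (a ≡ c × Adj B b d) ⊎ (Adj A a c × b ≡ d) } }

_∘ᴳ_ : {X Y : Set} → Graph X → Graph Y → Graph (X × Y)
A ∘ᴳ B = record { In = λ { (a , b) → In A a × In B b }
                ; Adj = λ { (a , b) (c , d) → Adj A a c ⊎ (a ≡ c × Adj B b d) } }

_⊔_ : {X : Set} → Graph X → Graph X → Graph X
A ⊔ B = record { In = λ x → In A x ⊎ In B x ; Adj = λ x y → Adj A x y ⊎ Adj B x y }

-- Every edge of P_r × K_t moves one layer along the path and changes colour, and with t ≥ 3
-- a third colour is always free; so a walk can follow any sequence of layers between prescribed
-- end colours, except that a single step must change colour.  Hence vertices n ≥ 2 layers apart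
-- are at distance n, distinct vertices of one layer at distance 2, and (i, a), (i ± 1, a) at
-- distance 3, parity and the colour change ruling out shorter walks.  A vertex having a neighbour
-- layer farther from v is not maximally distant from v, so MMD pairs at least two layers apart lie
-- on the two end layers; these are MMD unless r = 3 and the colours differ, when the middle vertex
-- of the far colour is at distance 3 > 2.  Adjacent layers are MMD exactly for equal colours, and a
-- layer is never MMD with itself.  Every vertex has a same-colour MMD partner, so ∂ is everything.

module Submission where

open import Defs
open import Data.Nat using (ℕ; zero; suc; _≤_; _<_; _+_; _∸_; z≤n; s≤s; ∣_-_∣; _<?_)
open import Data.Nat.Properties hiding (_≟_)
open import Data.Fin using (Fin; toℕ; fromℕ<; inject₁; _≟_) renaming (zero to fzero; suc to fsuc)
open import Data.Fin.Properties using (toℕ-fromℕ<; toℕ<n; toℕ-inject₁) renaming (<-cmp to <-cmpᶠ)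
open import Data.Product using (∃-syntax; _×_; _,_; proj₂; swap)
open import Data.Sum using (_⊎_; inj₁; inj₂; map₁; map₂)
open import Data.Unit using (tt)
open import Function using (id; _∘_)
open import Function.Bundles using (_⇔_; mk⇔)
open import Relation.Nullary using (¬_; yes; no; contradiction)
open import Relation.Binary.Definitions using (Symmetric; tri<; tri≈; tri>)
open import Relation.Binary.PropositionalEquality

module _ {X : Set} {G : Graph X} where

  walk-snoc : ∀ {u v w m} → Walk G u v m → Adj G v w → In G w → Walk G u w (suc m)
  walk-snoc (here p)     vw q = step p vw (here q)
  walk-snoc (step p a w) vw q = step p a (walk-snoc w vw q)

  walk-reverse : Symmetric (Adj G) → ∀ {u v m} → Walk G u v m → Walk G v u m
  walk-reverse adj-sym (here p)     = here p
  walk-reverse adj-sym (step p a w) = walk-snoc (walk-reverse adj-sym w) (adj-sym a) p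

  dist-sym : Symmetric (Adj G) → ∀ {u v k} → Dist G u v k → Dist G v u k
  dist-sym adj-sym (w , shortest) =
    walk-reverse adj-sym w , λ m w′ → shortest m (walk-reverse adj-sym w′)

  walk-≢⇒1≤ : ∀ {u v m} → u ≢ v → Walk G u v m → 1 ≤ m
  walk-≢⇒1≤ u≢v (here _)     = contradiction refl u≢v
  walk-≢⇒1≤ u≢v (step _ _ _) = s≤s z≤n

  walk-nonadjacent⇒2≤ : ∀ {u v m} → u ≢ v → ¬ Adj G u v → Walk G u v m → 2 ≤ m
  walk-nonadjacent⇒2≤ u≢v _   (here _)                = contradiction refl u≢v
  walk-nonadjacent⇒2≤ _   ¬uv (step _ uv (here _))    = contradiction uv ¬uv
  walk-nonadjacent⇒2≤ _   _   (step _ _ (step _ _ _)) = s≤s (s≤s z≤n)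

  dist-refl : ∀ {u} → In G u → Dist G u u 0
  dist-refl p = here p , λ _ _ → z≤n

  dist-adjacent : ∀ {u v} → In G u → In G v → Adj G u v → u ≢ v → Dist G u v 1
  dist-adjacent p q uv u≢v = step p uv (here q) , λ _ → walk-≢⇒1≤ u≢v

  farther-neighbour⇒¬maxDist : ∀ {u v w k l} → In G w → Adj G u w →
    Dist G v w k → Dist G u v l → l < k → ¬ MaxDist G u v
  farther-neighbour⇒¬maxDist p uw dvw duv l<k md = <⇒≱ l<k (md _ p uw _ _ dvw duv)

  near-neighbours⇒maxDist : ∀ {u v} l → (∀ m → Walk G u v m → l ≤ m) →
    (∀ w → In G w → Adj G u w → ∃[ m ] m ≤ l × Walk G v w m) → MaxDist G u v
  near-neighbours⇒maxDist l shortest near w p uw _ _ (_ , vw-shortest) (uv , _)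
    with near w p uw
  ... | m , m≤l , vw = ≤-trans (vw-shortest m vw) (≤-trans m≤l (shortest _ uv))

Iso-by-inverses : {X Y : Set} {G : Graph X} {H : Graph Y} (f : X → Y) (g : Y → X) →
  (∀ x → g (f x) ≡ x) → (∀ y → f (g y) ≡ y) → (∀ x → In G x) → (∀ y → In H y) →
  (∀ x y → Adj G x y ⇔ Adj H (f x) (f y)) → Iso G H
Iso-by-inverses f g gf fg inG inH adj =
  f ,
  (λ x _ → inH (f x)) ,
  (λ x y _ _ fx≡fy → trans (sym (gf x)) (trans (cong g fx≡fy) (gf y))) ,
  (λ y _ → g y , inG (g y) , fg y) ,
  (λ x y _ _ → adj x y)

-- Adjacency in Path r is, definitionally, Consecutive on toℕ.
Consecutive : ℕ → ℕ → Set
Consecutive m n = n ≡ suc m ⊎ m ≡ suc n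

consecutive-sym : Symmetric Consecutive
consecutive-sym (inj₁ e) = inj₂ e
consecutive-sym (inj₂ e) = inj₁ e

consecutive-irrefl : ∀ {n} → ¬ Consecutive n n
consecutive-irrefl (inj₁ e) = 1+n≢n (sym e)
consecutive-irrefl (inj₂ e) = 1+n≢n (sym e)

consecutive-triangle-free : ∀ {l m n} → Consecutive l m → Consecutive m n → ¬ Consecutive l n
consecutive-triangle-free (inj₁ refl) (inj₁ refl) (inj₁ ())
consecutive-triangle-free (inj₁ refl) (inj₁ refl) (inj₂ ())
consecutive-triangle-free (inj₁ refl) (inj₂ refl) (inj₁ ())
consecutive-triangle-free (inj₁ refl) (inj₂ refl) (inj₂ ())
consecutive-triangle-free (inj₂ refl) (inj₁ refl) (inj₁ ())
consecutive-triangle-free (inj₂ refl) (inj₁ refl) (inj₂ ())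
consecutive-triangle-free (inj₂ refl) (inj₂ refl) (inj₁ ())
consecutive-triangle-free (inj₂ refl) (inj₂ refl) (inj₂ ())

∣n-1+n∣≡1 : ∀ n → ∣ n - suc n ∣ ≡ 1
∣n-1+n∣≡1 zero    = refl
∣n-1+n∣≡1 (suc n) = ∣n-1+n∣≡1 n

consecutive⇒∣-∣≡1 : ∀ {m n} → Consecutive m n → ∣ m - n ∣ ≡ 1
consecutive⇒∣-∣≡1 {m}     (inj₁ refl) = ∣n-1+n∣≡1 m
consecutive⇒∣-∣≡1 {n = n} (inj₂ refl) = trans (∣-∣-comm (suc n) n) (∣n-1+n∣≡1 n)

module _ {r : ℕ} {Y : Set} {H : Graph Y} where

  walk-length-≥-gap : ∀ {i j : Fin r} {a b m} →
    Walk (Path r ×ᴳ H) (i , a) (j , b) m → ∣ toℕ i - toℕ j ∣ ≤ m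
  walk-length-≥-gap {i} (here _) = ≤-reflexive (∣n-n∣≡0 (toℕ i))
  walk-length-≥-gap {i} {j} (step {w = x , _} {k = m} _ (i~x , _) w) = begin
    ∣ toℕ i - toℕ j ∣                   ≤⟨ ∣-∣-triangle (toℕ i) (toℕ x) (toℕ j) ⟩
    ∣ toℕ i - toℕ x ∣ + ∣ toℕ x - toℕ j ∣ ≡⟨ cong (_+ _) (consecutive⇒∣-∣≡1 i~x) ⟩
    suc ∣ toℕ x - toℕ j ∣               ≤⟨ s≤s (walk-length-≥-gap w) ⟩
    suc m                               ∎
    where open ≤-Reasoning

  walk-length-≥-offset : ∀ {i j : Fin r} {a b n m} → toℕ j ≡ n + toℕ i →
    Walk (Path r ×ᴳ H) (i , a) (j , b) m → n ≤ m
  walk-length-≥-offset {i} {n = n} j≡n+i w = subst (_≤ _) gap≡n (walk-length-≥-gap w)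
    where
      gap≡n : ∣ toℕ i - _ ∣ ≡ n
      gap≡n = trans (cong (∣ toℕ i -_∣) (trans j≡n+i (+-comm n (toℕ i)))) (∣m-m+n∣≡n (toℕ i) n)

m<n⇒n≡1+[n∸1+m]+m : ∀ {m n} → m < n → n ≡ suc (n ∸ suc m) + m
m<n⇒n≡1+[n∸1+m]+m {m} {n} m<n = trans (sym (m∸n+n≡m m<n)) (+-suc (n ∸ suc m) m)

fresh-colour : ∀ {t} → 3 ≤ t → (a b : Fin t) → ∃[ c ] a ≢ c × b ≢ c
fresh-colour (s≤s (s≤s (s≤s _))) fzero        fzero        = fsuc fzero , (λ ()) , (λ ())
fresh-colour (s≤s (s≤s (s≤s _))) fzero        (fsuc fzero) = fsuc (fsuc fzero) , (λ ()) , (λ ())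
fresh-colour (s≤s (s≤s (s≤s _))) fzero        (fsuc (fsuc _)) = fsuc fzero , (λ ()) , (λ ())
fresh-colour (s≤s (s≤s (s≤s _))) (fsuc fzero) fzero        = fsuc (fsuc fzero) , (λ ()) , (λ ())
fresh-colour (s≤s (s≤s (s≤s _))) (fsuc fzero) (fsuc _)     = fzero , (λ ()) , (λ ())
fresh-colour (s≤s (s≤s (s≤s _))) (fsuc (fsuc _)) fzero     = fsuc fzero , (λ ()) , (λ ())
fresh-colour (s≤s (s≤s (s≤s _))) (fsuc (fsuc _)) (fsuc _)  = fzero , (λ ()) , (λ ())

module PathTimesComplete (k : ℕ) {t : ℕ} (t≥3 : 3 ≤ t) where

  -- r ∸ 1, the index of the last layer, reduces to suc k.
  r : ℕ
  r = suc (suc k)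

  V : Set
  V = Fin r × Fin t

  G : Graph V
  G = Path r ×ᴳ Complete t

  _~_ : Fin r → Fin r → Set
  i ~ j = Adj (Path r) i j

  adj-sym : Symmetric (Adj G)
  adj-sym (i~j , a≢b) = consecutive-sym i~j , ≢-sym a≢b

  adj⇒≢ : ∀ {u v} → Adj G u v → u ≢ v
  adj⇒≢ (i~i , _) refl = consecutive-irrefl i~i

  layer-succ : ∀ {i : Fin r} → suc (toℕ i) < r → ∃[ x ] toℕ x ≡ suc (toℕ i)
  layer-succ i+1<r = fromℕ< i+1<r , toℕ-fromℕ< i+1<r

  layer-between : ∀ {i j : Fin r} → toℕ j ≡ 2 + toℕ i → ∃[ x ] i ~ x × x ~ j
  layer-between {j = fsuc j} j≡2+i =
    inject₁ j ,
    inj₁ (trans (toℕ-inject₁ j) (suc-injective j≡2+i)) ,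
    inj₁ (cong suc (sym (toℕ-inject₁ j)))

  layer-neighbour : (i : Fin r) → ∃[ x ] i ~ x
  layer-neighbour fzero    = fsuc fzero , inj₁ refl
  layer-neighbour (fsuc i) = inject₁ i , inj₂ (cong suc (sym (toℕ-inject₁ i)))

  walk-1 : ∀ {i j a b} → i ~ j → a ≢ b → Walk G (i , a) (j , b) 1
  walk-1 i~j a≢b = step (tt , tt) (i~j , a≢b) (here (tt , tt))

  walk-2 : ∀ {i x j a b} → i ~ x → x ~ j → Walk G (i , a) (j , b) 2
  walk-2 {a = a} {b} i~x x~j with fresh-colour t≥3 a b
  ... | c , a≢c , b≢c = step (tt , tt) (i~x , a≢c) (walk-1 x~j (≢-sym b≢c))

  walk-3 : ∀ {i j a b} → i ~ j → Walk G (i , a) (j , b) 3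
  walk-3 {a = a} i~j with fresh-colour t≥3 a a
  ... | c , a≢c , _ = step (tt , tt) (i~j , a≢c) (walk-2 (consecutive-sym i~j) i~j)

  walk-up : ∀ n {i j a b} → toℕ j ≡ suc n + toℕ i → (1 ≤ n ⊎ a ≢ b) →
    Walk G (i , a) (j , b) (suc n)
  walk-up zero    j≡1+i (inj₂ a≢b) = walk-1 (inj₁ j≡1+i) a≢b
  walk-up (suc n) {j = fsuc j} {a} {b} j≡n+i _ with fresh-colour t≥3 a b
  ... | c , a≢c , b≢c =
    walk-snoc (walk-up n (trans (toℕ-inject₁ j) (suc-injective j≡n+i)) (inj₂ a≢c))
              (inj₁ (cong suc (sym (toℕ-inject₁ j))) , b≢c ∘ sym) (tt , tt)

  walk-same-colour-3≤ : ∀ {i j a m} → i ~ j → Walk G (i , a) (j , a) m → 3 ≤ m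
  walk-same-colour-3≤ i~i (here _)                    = contradiction i~i consecutive-irrefl
  walk-same-colour-3≤ _   (step _ (_ , a≢a) (here _)) = contradiction refl a≢a
  walk-same-colour-3≤ i~j (step _ (i~x , _) (step _ (x~j , _) (here _))) =
    contradiction i~j (consecutive-triangle-free i~x x~j)
  walk-same-colour-3≤ _   (step _ _ (step _ _ (step _ _ _))) = s≤s (s≤s (s≤s z≤n))

  dist-adjacent-layers : ∀ {i j a b} → i ~ j → a ≢ b → Dist G (i , a) (j , b) 1
  dist-adjacent-layers i~j a≢b = dist-adjacent (tt , tt) (tt , tt) (i~j , a≢b) (adj⇒≢ (i~j , a≢b))

  dist-common-neighbour : ∀ {i x j a b} → i ~ x → x ~ j → (i , a) ≢ (j , b) →
    Dist G (i , a) (j , b) 2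
  dist-common-neighbour i~x x~j u≢v =
    walk-2 i~x x~j ,
    λ _ → walk-nonadjacent⇒2≤ u≢v λ (i~j , _) → consecutive-triangle-free i~x x~j i~j

  dist-same-colour : ∀ {i j a} → i ~ j → Dist G (i , a) (j , a) 3
  dist-same-colour i~j = walk-3 i~j , λ _ → walk-same-colour-3≤ i~j

  dist-up : ∀ n {i j a b} → toℕ j ≡ suc n + toℕ i → (1 ≤ n ⊎ a ≢ b) →
    Dist G (i , a) (j , b) (suc n)
  dist-up n j≡ cond = walk-up n j≡ cond , λ _ → walk-length-≥-offset j≡

  ¬maxDist-self : ∀ {i a} → ¬ MaxDist G (i , a) (i , a)
  ¬maxDist-self {i} {a} with layer-neighbour i | fresh-colour t≥3 a a
  ... | x , i~x | c , a≢c , _ =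
    farther-neighbour⇒¬maxDist (tt , tt) (i~x , a≢c)
      (dist-adjacent-layers i~x a≢c) (dist-refl (tt , tt)) ≤-refl

  ¬maxDist-common-neighbour : ∀ {i x j a b} → i ~ x → x ~ j → a ≢ b →
    ¬ MaxDist G (i , a) (j , b)
  ¬maxDist-common-neighbour i~x x~j a≢b =
    farther-neighbour⇒¬maxDist (tt , tt) (i~x , a≢b)
      (dist-same-colour (consecutive-sym x~j))
      (dist-common-neighbour i~x x~j (a≢b ∘ cong proj₂)) ≤-refl

  ¬maxDist-adjacent-layers : ∀ {i j a b} → i ~ j → a ≢ b → ¬ MaxDist G (i , a) (j , b)
  ¬maxDist-adjacent-layers {a = a} {b} i~j a≢b with fresh-colour t≥3 a b
  ... | c , a≢c , b≢c =
    farther-neighbour⇒¬maxDist (tt , tt) (i~j , a≢c)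
      (dist-common-neighbour (consecutive-sym i~j) i~j (b≢c ∘ cong proj₂))
      (dist-adjacent-layers i~j a≢b) ≤-refl

  ¬maxDist-receding-down : ∀ n {i x j a b} → toℕ i ≡ suc (toℕ x) →
    toℕ j ≡ suc (suc n) + toℕ i → ¬ MaxDist G (i , a) (j , b)
  ¬maxDist-receding-down n {i} {x} {j} {a} i≡1+x j≡ with fresh-colour t≥3 a a
  ... | c , a≢c , _ =
    farther-neighbour⇒¬maxDist (tt , tt) (inj₂ i≡1+x , a≢c)
      (dist-sym adj-sym (dist-up (suc (suc n)) j≡3+n+x (inj₁ (s≤s z≤n))))
      (dist-up (suc n) j≡ (inj₁ (s≤s z≤n))) ≤-refl
    where
      j≡3+n+x : toℕ j ≡ suc (suc (suc n)) + toℕ x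
      j≡3+n+x = trans j≡ (trans (cong (suc (suc n) +_) i≡1+x) (+-suc (suc (suc n)) (toℕ x)))

  ¬maxDist-receding-up : ∀ n {i j y a b} → toℕ y ≡ suc (toℕ j) →
    toℕ j ≡ suc (suc n) + toℕ i → ¬ MaxDist G (j , b) (i , a)
  ¬maxDist-receding-up n {b = b} y≡1+j j≡ with fresh-colour t≥3 b b
  ... | c , b≢c , _ =
    farther-neighbour⇒¬maxDist (tt , tt) (inj₁ y≡1+j , b≢c)
      (dist-up (suc (suc n)) (trans y≡1+j (cong suc j≡)) (inj₁ (s≤s z≤n)))
      (dist-sym adj-sym (dist-up (suc n) j≡ (inj₁ (s≤s z≤n)))) ≤-refl

  maxDist-same-colour : ∀ {i j a} → i ~ j → MaxDist G (i , a) (j , a)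
  maxDist-same-colour i~j = near-neighbours⇒maxDist 3 (λ _ → walk-same-colour-3≤ i~j)
    λ { (x , c) _ (i~x , _) → 2 , n≤1+n 2 , walk-2 (consecutive-sym i~j) i~x }

  MMD-same-colour : ∀ {i j a} → i ~ j → MMD G (i , a) (j , a)
  MMD-same-colour i~j = maxDist-same-colour i~j , maxDist-same-colour (consecutive-sym i~j)

  maxDist-from-first : ∀ n {i j a b} → toℕ i ≡ 0 → toℕ j ≡ suc (suc n) + toℕ i →
    (1 ≤ n ⊎ a ≡ b) → MaxDist G (i , a) (j , b)
  maxDist-from-first n {i} {j} {a} {b} i≡0 j≡ cond =
    near-neighbours⇒maxDist (suc (suc n)) (λ _ → walk-length-≥-offset j≡) near
    where
      near : ∀ w → In G w → Adj G (i , a) w → ∃[ m ] m ≤ suc (suc n) × Walk G (j , b) w m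
      near (x , c) _ (inj₁ x≡1+i , a≢c) =
        suc n , n≤1+n _ ,
        walk-reverse adj-sym
          (walk-up n j≡1+n+x (map₂ (λ a≡b c≡b → a≢c (trans a≡b (sym c≡b))) cond))
        where
          j≡1+n+x : toℕ j ≡ suc n + toℕ x
          j≡1+n+x = trans j≡ (trans (sym (+-suc (suc n) (toℕ i))) (cong (suc n +_) (sym x≡1+i)))
      near (x , c) _ (inj₂ i≡1+x , _) = contradiction (trans (sym i≡0) i≡1+x) 0≢1+n

  maxDist-from-last : ∀ n {i j a b} → suc (toℕ j) ≡ r → toℕ j ≡ suc (suc n) + toℕ i →
    (1 ≤ n ⊎ a ≡ b) → MaxDist G (j , b) (i , a)
  maxDist-from-last n {i} {j} {a} {b} j+1≡r j≡ cond =
    near-neighbours⇒maxDist (suc (suc n)) (λ _ → walk-length-≥-offset j≡ ∘ walk-reverse adj-sym)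
      near
    where
      near : ∀ w → In G w → Adj G (j , b) w → ∃[ m ] m ≤ suc (suc n) × Walk G (i , a) w m
      near (x , c) _ (inj₁ x≡1+j , _) = contradiction (toℕ<n x) (<-irrefl (trans x≡1+j j+1≡r))
      near (x , c) _ (inj₂ j≡1+x , b≢c) =
        suc n , n≤1+n _ ,
        walk-up n (suc-injective (trans (sym j≡1+x) j≡))
          (map₂ (λ a≡b a≡c → b≢c (trans (sym a≡b) a≡c)) cond)

  SREdge : V → V → Set
  SREdge (i , a) (j , b) = (i ~ j × a ≡ b) ⊎ (Adj (EndsEdge r) i j × (a ≡ b ⊎ 4 ≤ r))

  SREdge-sym : ∀ {u v} → SREdge u v → SREdge v u
  SREdge-sym (inj₁ (i~j , a≡b))               = inj₁ (consecutive-sym i~j , sym a≡b)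
  SREdge-sym (inj₂ (inj₁ (i≡0 , j≡1+k) , cond)) = inj₂ (inj₂ (j≡1+k , i≡0) , map₁ sym cond)
  SREdge-sym (inj₂ (inj₂ (i≡1+k , j≡0) , cond)) = inj₂ (inj₁ (j≡0 , i≡1+k) , map₁ sym cond)

  far-ends-condition : ∀ n {a b : Fin t} → suc (suc (suc n)) ≡ r → (a ≡ b ⊎ 4 ≤ r) →
    1 ≤ n ⊎ a ≡ b
  far-ends-condition (suc n) _    _                          = inj₁ (s≤s z≤n)
  far-ends-condition zero    _    (inj₁ a≡b)                 = inj₂ a≡b
  far-ends-condition zero    refl (inj₂ (s≤s (s≤s (s≤s ()))))

  ends⇒MMD : ∀ m {i j a b} → toℕ i ≡ 0 → toℕ j ≡ suc m → suc (suc m) ≡ r →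
    (a ≡ b ⊎ 4 ≤ r) → MMD G (i , a) (j , b)
  ends⇒MMD zero    i≡0 j≡1 _    (inj₁ refl) =
    MMD-same-colour (inj₁ (trans j≡1 (cong suc (sym i≡0))))
  ends⇒MMD zero    _   _   refl (inj₂ (s≤s (s≤s ())))
  ends⇒MMD (suc n) {i} {j} i≡0 j≡2+n r≡ cond =
    maxDist-from-first n i≡0 j≡ cond′ ,
    maxDist-from-last n (trans (cong suc j≡2+n) r≡) j≡ cond′
    where
      j≡ : toℕ j ≡ suc (suc n) + toℕ i
      j≡ = trans j≡2+n (sym (trans (cong (suc (suc n) +_) i≡0) (+-identityʳ (suc (suc n)))))
      cond′ = far-ends-condition n r≡ cond

  SREdge⇒MMD : ∀ {u v} → SREdge u v → MMD G u v
  SREdge⇒MMD (inj₁ (i~j , refl))                = MMD-same-colour i~j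
  SREdge⇒MMD (inj₂ (inj₁ (i≡0 , j≡1+k) , cond)) = ends⇒MMD k i≡0 j≡1+k refl cond
  SREdge⇒MMD (inj₂ (inj₂ (i≡1+k , j≡0) , cond)) =
    swap (ends⇒MMD k j≡0 i≡1+k refl (map₁ sym cond))

  ¬MMD-same-layer : ∀ {i a b} → ¬ MMD G (i , a) (i , b)
  ¬MMD-same-layer {i} {a} {b} (md , _) with a ≟ b | layer-neighbour i
  ... | yes refl | _       = ¬maxDist-self md
  ... | no a≢b   | x , i~x = ¬maxDist-common-neighbour i~x (consecutive-sym i~x) a≢b md

  MMD-far⇒ends : ∀ n {i j a b} → toℕ j ≡ suc (suc n) + toℕ i → MMD G (i , a) (j , b) →
    toℕ i ≡ 0 × toℕ j ≡ suc k
  MMD-far⇒ends n {fsuc i} j≡ (md , _) =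
    contradiction md
      (¬maxDist-receding-down n {x = inject₁ i} (cong suc (sym (toℕ-inject₁ i))) j≡)
  MMD-far⇒ends n {fzero} {j} j≡ (_ , md) with suc (toℕ j) <? r
  ... | yes j+1<r = contradiction md (¬maxDist-receding-up n (proj₂ (layer-succ j+1<r)) j≡)
  ... | no  j+1≮r = refl , suc-injective (≤-antisym (toℕ<n j) (≮⇒≥ j+1≮r))

  MMD-ends⇒colours : ∀ n {i j a b} → toℕ j ≡ suc (suc n) + toℕ i → toℕ j ≡ suc k →
    MMD G (i , a) (j , b) → a ≡ b ⊎ 4 ≤ r
  MMD-ends⇒colours (suc n) j≡ j≡1+k _ =
    inj₂ (subst (λ m → 4 ≤ suc m) (trans (sym j≡) j≡1+k) (s≤s (s≤s (s≤s (s≤s z≤n)))))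
  MMD-ends⇒colours zero {a = a} {b} j≡ _ (md , _) with a ≟ b | layer-between j≡
  ... | yes a≡b | _               = inj₁ a≡b
  ... | no a≢b  | x , i~x , x~j = contradiction md (¬maxDist-common-neighbour i~x x~j a≢b)

  MMD-upward⇒SREdge : ∀ n {i j a b} → toℕ j ≡ suc n + toℕ i → MMD G (i , a) (j , b) →
    SREdge (i , a) (j , b)
  MMD-upward⇒SREdge zero {a = a} {b} j≡1+i (md , _) with a ≟ b
  ... | yes a≡b = inj₁ (inj₁ j≡1+i , a≡b)
  ... | no a≢b  = contradiction md (¬maxDist-adjacent-layers (inj₁ j≡1+i) a≢b)
  MMD-upward⇒SREdge (suc n) j≡ mmd with MMD-far⇒ends n j≡ mmd
  ... | i≡0 , j≡1+k = inj₂ (inj₁ (i≡0 , j≡1+k) , MMD-ends⇒colours n j≡ j≡1+k mmd)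

  MMD⇒SREdge : ∀ {u v} → MMD G u v → SREdge u v
  MMD⇒SREdge {i , _} {j , _} mmd with <-cmpᶠ i j
  ... | tri< i<j _ _  = MMD-upward⇒SREdge _ (m<n⇒n≡1+[n∸1+m]+m i<j) mmd
  ... | tri≈ _ refl _ = contradiction mmd ¬MMD-same-layer
  ... | tri> _ _ j<i  = SREdge-sym (MMD-upward⇒SREdge _ (m<n⇒n≡1+[n∸1+m]+m j<i) (swap mmd))

  boundary : ∀ u → Boundary G u
  boundary (i , a) =
    let x , i~x = layer-neighbour i in (tt , tt) , (x , a) , (tt , tt) , maxDist-same-colour i~x

  SR-iso-long : 4 ≤ r → Iso (SR G) ((Path r □ EmptyG t) ⊔ (EndsEdge r ∘ᴳ EmptyG t))
  SR-iso-long 4≤r =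
    Iso-by-inverses id id (λ _ → refl) (λ _ → refl) boundary (λ _ → inj₁ (tt , tt))
      λ { (i , a) (j , b) → mk⇔ (to ∘ MMD⇒SREdge) (SREdge⇒MMD ∘ from) }
    where
      H : Graph V
      H = (Path r □ EmptyG t) ⊔ (EndsEdge r ∘ᴳ EmptyG t)

      to : ∀ {i j a b} → SREdge (i , a) (j , b) → Adj H (i , a) (j , b)
      to (inj₁ consecutive) = inj₁ (inj₂ consecutive)
      to (inj₂ (ends , _))  = inj₂ (inj₁ ends)

      from : ∀ {i j a b} → Adj H (i , a) (j , b) → SREdge (i , a) (j , b)
      from (inj₁ (inj₂ consecutive)) = inj₁ consecutive
      from (inj₂ (inj₁ ends))        = inj₂ (ends , inj₂ 4≤r)

  short-path-complete : k ≤ 1 → ∀ {i j} → i ≢ j → i ~ j ⊎ Adj (EndsEdge r) i j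
  short-path-complete z≤n       {fzero}             {fzero}             i≢j = contradiction refl i≢j
  short-path-complete z≤n       {fzero}             {fsuc fzero}        _   = inj₁ (inj₁ refl)
  short-path-complete z≤n       {fsuc fzero}        {fzero}             _   = inj₁ (inj₂ refl)
  short-path-complete z≤n       {fsuc fzero}        {fsuc fzero}        i≢j = contradiction refl i≢j
  short-path-complete (s≤s z≤n) {fzero}             {fzero}             i≢j = contradiction refl i≢j
  short-path-complete (s≤s z≤n) {fzero}             {fsuc fzero}        _   = inj₁ (inj₁ refl)
  short-path-complete (s≤s z≤n) {fzero}             {fsuc (fsuc fzero)} _   = inj₂ (inj₁ (refl , refl))
  short-path-complete (s≤s z≤n) {fsuc fzero}        {fzero}             _   = inj₁ (inj₂ refl)
  short-path-complete (s≤s z≤n) {fsuc fzero}        {fsuc fzero}        i≢j = contradiction refl i≢j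
  short-path-complete (s≤s z≤n) {fsuc fzero}        {fsuc (fsuc fzero)} _   = inj₁ (inj₁ refl)
  short-path-complete (s≤s z≤n) {fsuc (fsuc fzero)} {fzero}             _   = inj₂ (inj₂ (refl , refl))
  short-path-complete (s≤s z≤n) {fsuc (fsuc fzero)} {fsuc fzero}        _   = inj₁ (inj₂ refl)
  short-path-complete (s≤s z≤n) {fsuc (fsuc fzero)} {fsuc (fsuc fzero)} i≢j = contradiction refl i≢j

  SR-iso-short : k ≤ 1 → Iso (SR G) (Copies t (Complete r))
  SR-iso-short k≤1 =
    Iso-by-inverses swap swap (λ _ → refl) (λ _ → refl) boundary (λ _ → tt)
      λ { (i , a) (j , b) → mk⇔ (to ∘ MMD⇒SREdge) (SREdge⇒MMD ∘ from) }
    where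
      to : ∀ {i j a b} → SREdge (i , a) (j , b) → a ≡ b × i ≢ j
      to (inj₁ (i~j , a≡b))                    = a≡b , λ { refl → consecutive-irrefl i~j }
      to (inj₂ (inj₁ (i≡0 , j≡1+k) , inj₁ a≡b)) = a≡b , λ { refl → 0≢1+n (trans (sym i≡0) j≡1+k) }
      to (inj₂ (inj₂ (i≡1+k , j≡0) , inj₁ a≡b)) = a≡b , λ { refl → 0≢1+n (trans (sym j≡0) i≡1+k) }
      to (inj₂ (_ , inj₂ (s≤s (s≤s 2≤k))))      = contradiction 2≤k (≤⇒≯ k≤1)

      from : ∀ {i j a b} → a ≡ b × i ≢ j → SREdge (i , a) (j , b)
      from (a≡b , i≢j) with short-path-complete k≤1 i≢j
      ... | inj₁ i~j  = inj₁ (i~j , a≡b)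
      ... | inj₂ ends = inj₂ (ends , inj₁ a≡b)

proposition34 : (r t : ℕ) → 2 ≤ r → 3 ≤ t →
    ((r ≡ 2 ⊎ r ≡ 3) → Iso (SR (Path r ×ᴳ Complete t)) (Copies t (Complete r)))
    × (4 ≤ r → Iso (SR (Path r ×ᴳ Complete t)) ((Path r □ EmptyG t) ⊔ (EndsEdge r ∘ᴳ EmptyG t)))
proposition34 (suc (suc k)) t (s≤s (s≤s z≤n)) t≥3 = SR-iso-short ∘ k≤1 , SR-iso-long
  where
    open PathTimesComplete k t≥3

    k≤1 : suc (suc k) ≡ 2 ⊎ suc (suc k) ≡ 3 → k ≤ 1
    k≤1 (inj₁ refl) = z≤n
    k≤1 (inj₂ refl) = s≤s z≤n
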